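{- There exist a constant $c>0$ and, for each $n \ge 1$, a language $L_n$ accepted by a DFA with $O(n)$ states that is not factor-free and such that every witness $(v,w)$ to the failure of factor-freeness of $L_n$ satisfies $|w| \ge c n^2$; i.e. the smallest witness has size $\Omega(n^2)$.
   Context: A word $v$ is a factor of $w$ if $w = xvy$ for some words $x,y$. $L$ is factor-free if no word of $L$ has a factor different from itself that lies in $L$. A witness to the failure of factor-freeness is a pair $(v,w)$ with $v,w \in L$, $v$ a factor of $w$, $v \ne w$; its size is $|w|$. -}

module Defs where

open import Data.Nat using (ℕ)
open import Data.Fin using (Fin)
open import Data.Bool using (Bool; true)
open import Data.List using (List; []; _∷_; _++_)
open import Data.Product using (∃; _×_)
open import Relation.Binary.PropositionalEquality using (_≡_)
open import Relation.Nullary using (¬_)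

record DFA (k m : ℕ) : Set where
  field
    δ      : Fin m → Fin k → Fin m
    start  : Fin m
    accept : Fin m → Bool

Word : ℕ → Set
Word k = List (Fin k)

δ* : ∀ {k m} → DFA k m → Fin m → Word k → Fin m
δ* A q []       = q
δ* A q (a ∷ w)  = δ* A (DFA.δ A q a) w

Accepts : ∀ {k m} → DFA k m → Word k → Set
Accepts A w = DFA.accept A (δ* A (DFA.start A) w) ≡ true

Factor : ∀ {k} → Word k → Word k → Set
Factor {k} v w = ∃ λ (x : Word k) → ∃ λ (y : Word k) → w ≡ x ++ v ++ y

Witness : ∀ {k m} → DFA k m → Word k → Word k → Set
Witness A v w = Accepts A v × Accepts A w × Factor v w × ¬ (v ≡ w)

FactorFree : ∀ {k m} → DFA k m → Set
FactorFree {k} A = (v w : Word k) → ¬ Witness A v w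

-- Let L consist of the words b aⁱ b with n ∣ i + 1 and c b aⁱ b with n + 1 ∣ i + 1.
-- A DFA recognises L with two counters, modulo n and modulo n + 1, hence with O(n)
-- states. A word of L can be a proper factor of another word of L only as b aⁱ b
-- inside c b aⁱ b, which forces n ∣ i + 1 and n + 1 ∣ i + 1; as n and n + 1 are
-- coprime, n (n + 1) ∣ i + 1, so the longer word has length i + 3 > n². Taking
-- i + 1 = n (n + 1) shows that such a pair exists.
module Submission where

open import Defs
open import Data.Nat using (ℕ; _≤_; _*_)
open import Data.List using (length)
open import Data.Product using (∃; _×_)
open import Relation.Nullary using (¬_)

open import Data.Nat using (zero; suc; _+_; _/_; _%_; _≟_; pred)
open import Data.Nat.Properties
open import Data.Nat.DivMod
  using (m≡m%n+[m/n]*n; m%n<n; m%n%n≡m%n; %-distribˡ-+; [m+kn]%n≡m%n; m≤n⇒m%n≡m; m<n⇒m%n≡m)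
open import Data.Nat.Divisibility using (_∣_; divides; ∣⇒≤; m∣m*n; n∣m*n; *-monoˡ-∣)
open import Data.Nat.Coprimality as Coprimality using (Coprime; coprime-+; 1-coprimeTo; coprime-divisor)
open import Data.Nat.Tactic.RingSolver using (solve-∀)
open import Data.Fin as Fin using (Fin; toℕ; fromℕ<; splitAt; _↑ˡ_; _↑ʳ_)
open import Data.Fin.Properties using (toℕ-fromℕ<; toℕ<n; splitAt-↑ˡ; splitAt-↑ʳ)
open import Data.Bool using (Bool; true; false)
open import Data.Sum using ([_,_]′)
open import Data.List using ([]; _∷_; _++_; [_]; replicate; foldl)
open import Data.List.Properties using (++-identityʳ; ∷-injectiveʳ)
open import Data.Product using (_,_; proj₁; proj₂)
open import Data.Empty using (⊥-elim)
open import Function using (_∘_)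
open import Function.Bundles using (_⇔_; mk⇔; Equivalence)
open import Function.Construct.Composition using (_⇔-∘_)
open import Relation.Nullary using (Dec; yes; no)
open import Relation.Binary.PropositionalEquality hiding ([_])

%≡pred⇒∣suc : ∀ {m i} → i % suc m ≡ m → suc m ∣ suc i
%≡pred⇒∣suc {m} {i} eq = divides (suc (i / suc m)) (cong suc (begin
  i                             ≡⟨ m≡m%n+[m/n]*n i (suc m) ⟩
  i % suc m + i / suc m * suc m ≡⟨ cong (_+ i / suc m * suc m) eq ⟩
  m + i / suc m * suc m         ∎))
  where open ≡-Reasoning

∣suc⇒%≡pred : ∀ {m i} → suc m ∣ suc i → i % suc m ≡ m
∣suc⇒%≡pred {m} {i} (divides (suc k) eq) = begin
  i % suc m              ≡⟨ cong (_% suc m) (suc-injective eq) ⟩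
  (m + k * suc m) % suc m ≡⟨ [m+kn]%n≡m%n m k (suc m) ⟩
  m % suc m              ≡⟨ m≤n⇒m%n≡m ≤-refl ⟩
  m                      ∎
  where open ≡-Reasoning

coprime-∣⇒*∣ : ∀ {p q k} → Coprime p q → p ∣ k → q ∣ k → p * q ∣ k
coprime-∣⇒*∣ {p} {q} p⊥q p∣k (divides j refl) =
  *-monoˡ-∣ q (coprime-divisor p⊥q (subst (p ∣_) (*-comm j q) p∣k))

coprime-suc : ∀ p → Coprime p (suc p)
coprime-suc p = subst (Coprime p) (+-comm p 1) (Coprimality.sym (coprime-+ (1-coprimeTo p)))

pattern a = Fin.zero
pattern b = Fin.suc Fin.zero
pattern c = Fin.suc (Fin.suc Fin.zero)

block : ℕ → Word 3
block i = replicate i a ++ [ b ]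

length-block : ∀ i → length (block i) ≡ suc i
length-block zero    = refl
length-block (suc i) = cong suc (length-block i)

block-++≢[] : ∀ i y → block i ++ y ≢ []
block-++≢[] zero    y ()
block-++≢[] (suc i) y ()

block-split : ∀ i x {z} u → z ≢ a → block i ≡ x ++ z ∷ u → z ≡ b × u ≡ []
block-split zero    []          u z≢a refl = refl , refl
block-split zero    (_ ∷ [])    u z≢a ()
block-split zero    (_ ∷ _ ∷ _) u z≢a ()
block-split (suc i) []          u z≢a refl = ⊥-elim (z≢a refl)
block-split (suc i) (_ ∷ x)     u z≢a eq = block-split i x u z≢a (∷-injectiveʳ eq)

block-prefix : ∀ i j y → block i ≡ block j ++ y → j ≡ i
block-prefix zero    zero    y eq = refl
block-prefix (suc i) (suc j) y eq = cong suc (block-prefix i j y (∷-injectiveʳ eq))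
block-prefix zero    (suc j) y ()
block-prefix (suc i) zero    y ()

c∉b∷block : ∀ i x u → b ∷ block i ≢ x ++ c ∷ u
c∉b∷block i []      u ()
c∉b∷block i (_ ∷ x) u eq with () ← proj₁ (block-split i x u (λ ()) (∷-injectiveʳ eq))

b∷block-factor : ∀ i j x y → b ∷ block i ≡ x ++ (b ∷ block j) ++ y → j ≡ i
b∷block-factor i j []      y eq = block-prefix i j y (∷-injectiveʳ eq)
b∷block-factor i j (_ ∷ x) y eq =
  ⊥-elim (block-++≢[] j y (proj₂ (block-split i x (block j ++ y) (λ ()) (∷-injectiveʳ eq))))

data Lang (p q : ℕ) : Word 3 → Set where
  unmarked : ∀ {i} → p ∣ suc i → Lang p q (b ∷ block i)
  marked   : ∀ {i} → q ∣ suc i → Lang p q (c ∷ b ∷ block i)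

Lang-proper-factor : ∀ {p q v w} → Lang p q v → Lang p q w → Factor v w → v ≢ w →
                     ∃ λ i → p ∣ suc i × q ∣ suc i × w ≡ c ∷ b ∷ block i
Lang-proper-factor (unmarked {j} _) (unmarked {i} _) (x , y , eq) v≢w =
  ⊥-elim (v≢w (cong (λ k → b ∷ block k) (b∷block-factor i j x y eq)))
Lang-proper-factor (marked _) (unmarked {i} _) (x , y , eq) _ = ⊥-elim (c∉b∷block i x _ eq)
Lang-proper-factor (unmarked {j} p∣) (marked {i} q∣) (_ ∷ x , y , eq) _
  with refl ← b∷block-factor i j x y (∷-injectiveʳ eq) = i , p∣ , q∣ , refl
Lang-proper-factor (marked {j} _) (marked {i} _) ([] , y , eq) v≢w =
  ⊥-elim (v≢w (cong (λ k → c ∷ b ∷ block k) (b∷block-factor i j [] y (∷-injectiveʳ eq))))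
Lang-proper-factor (marked _) (marked {i} _) (_ ∷ x , y , eq) _ =
  ⊥-elim (c∉b∷block i x _ (∷-injectiveʳ eq))

consecutive-∣⇒square≤ : ∀ {p i} → p ∣ suc i → suc p ∣ suc i → p * p ≤ length (c ∷ b ∷ block i)
consecutive-∣⇒square≤ {p} {i} p∣ sp∣ = begin
  p * p                       ≤⟨ *-monoʳ-≤ p (n≤1+n p) ⟩
  p * suc p                   ≤⟨ ∣⇒≤ (coprime-∣⇒*∣ (coprime-suc p) p∣ sp∣) ⟩
  suc i                       ≤⟨ m≤n+m (suc i) 2 ⟩
  2 + suc i                   ≡⟨ cong (2 +_) (length-block i) ⟨
  length (c ∷ b ∷ block i)    ∎
  where open ≤-Reasoning

encodeDFA : ∀ {k m} {S : Set} → (S → Fin m) → (Fin m → S) → (S → Fin k → S) → S → (S → Bool) → DFA k m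
encodeDFA enc dec δ s₀ final = record
  { δ = λ q x → enc (δ (dec q) x) ; start = enc s₀ ; accept = final ∘ dec }

module _ {k m} {S : Set} (enc : S → Fin m) (dec : Fin m → S) (dec∘enc : ∀ s → dec (enc s) ≡ s)
         (δ : S → Fin k → S) (s₀ : S) (final : S → Bool) where

  private
    A : DFA k m
    A = encodeDFA enc dec δ s₀ final

  δ*-encodeDFA : ∀ s w → δ* A (enc s) w ≡ enc (foldl δ s w)
  δ*-encodeDFA s []      = refl
  δ*-encodeDFA s (x ∷ w) rewrite dec∘enc s = δ*-encodeDFA (δ s x) w

  Accepts-encodeDFA : ∀ w → Accepts A w ⇔ final (foldl δ s₀ w) ≡ true
  Accepts-encodeDFA w = mk⇔ (trans (sym same)) (trans same)
    where
    same : final (dec (δ* A (enc s₀) w)) ≡ final (foldl δ s₀ w)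
    same = cong final (trans (cong dec (δ*-encodeDFA s₀ w)) (dec∘enc (foldl δ s₀ w)))

tick : ∀ {m} → Fin (suc m) → Fin (suc m)
tick {m} r = fromℕ< (m%n<n (suc (toℕ r)) (suc m))

tick-shift : ∀ {m} (r : Fin (suc m)) i → (toℕ (tick r) + i) % suc m ≡ (toℕ r + suc i) % suc m
tick-shift {m} r i = begin
  (toℕ (tick r) + i) % p            ≡⟨ cong (λ z → (z + i) % p) (toℕ-fromℕ< (m%n<n (suc (toℕ r)) p)) ⟩
  (suc (toℕ r) % p + i) % p         ≡⟨ %-distribˡ-+ (suc (toℕ r) % p) i p ⟩
  (suc (toℕ r) % p % p + i % p) % p ≡⟨ cong (λ z → (z + i % p) % p) (m%n%n≡m%n (suc (toℕ r)) p) ⟩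
  (suc (toℕ r) % p + i % p) % p     ≡⟨ %-distribˡ-+ (suc (toℕ r)) i p ⟨
  (suc (toℕ r) + i) % p             ≡⟨ cong (_% p) (+-suc (toℕ r) i) ⟨
  (toℕ r + suc i) % p               ∎
  where
  open ≡-Reasoning
  p : ℕ
  p = suc m

toℕ+0%≡toℕ : ∀ {m} (r : Fin (suc m)) → (toℕ r + 0) % suc m ≡ toℕ r
toℕ+0%≡toℕ r rewrite +-identityʳ (toℕ r) = m<n⇒m%n≡m (toℕ<n r)

module Automaton (s t : ℕ) where

  data Track : Set where
    unmarked marked : Track

  top : Track → ℕ
  top unmarked = s
  top marked   = t

  data State : Set where
    initial afterMark accept dead : State
    count : (tr : Track) → Fin (suc (top tr)) → State

  accept-if : ∀ {P : Set} → Dec P → State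
  accept-if (yes _) = accept
  accept-if (no _)  = dead

  step : State → Fin 3 → State
  step initial      a = dead
  step initial      b = count unmarked Fin.zero
  step initial      c = afterMark
  step afterMark    a = dead
  step afterMark    b = count marked Fin.zero
  step afterMark    c = dead
  step (count tr r) a = count tr (tick r)
  step (count tr r) b = accept-if (toℕ r ≟ top tr)
  step (count tr r) c = dead
  step accept       _ = dead
  step dead         _ = dead

  final : State → Bool
  final accept = true
  final _      = false

  dead-rejects : ∀ w → foldl step dead w ≢ accept
  dead-rejects []      ()
  dead-rejects (_ ∷ w) = dead-rejects w

  accept-accepts⁻ : ∀ w → foldl step accept w ≡ accept → w ≡ []
  accept-accepts⁻ []      _  = refl
  accept-accepts⁻ (_ ∷ w) eq = ⊥-elim (dead-rejects w eq)

  count-accepts⁻ : ∀ tr r w → foldl step (count tr r) w ≡ accept →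
                   ∃ λ i → w ≡ block i × (toℕ r + i) % suc (top tr) ≡ top tr
  count-accepts⁻ tr r []      ()
  count-accepts⁻ tr r (a ∷ w) eq with count-accepts⁻ tr (tick r) w eq
  ... | i , refl , h = suc i , refl , trans (sym (tick-shift r i)) h
  count-accepts⁻ tr r (b ∷ w) eq with toℕ r ≟ top tr
  ... | yes r≡top = 0 , cong (b ∷_) (accept-accepts⁻ w eq) , trans (toℕ+0%≡toℕ r) r≡top
  ... | no _      = ⊥-elim (dead-rejects w eq)
  count-accepts⁻ tr r (c ∷ w) eq = ⊥-elim (dead-rejects w eq)

  count-accepts⁺ : ∀ tr r i → (toℕ r + i) % suc (top tr) ≡ top tr → foldl step (count tr r) (block i) ≡ accept
  count-accepts⁺ tr r zero h with toℕ r ≟ top tr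
  ... | yes _     = refl
  ... | no r≢top  = ⊥-elim (r≢top (trans (sym (toℕ+0%≡toℕ r)) h))
  count-accepts⁺ tr r (suc i) h = count-accepts⁺ tr (tick r) i (trans (tick-shift r i) h)

  initial-accepts⁻ : ∀ w → foldl step initial w ≡ accept → Lang (suc s) (suc t) w
  initial-accepts⁻ []          ()
  initial-accepts⁻ (a ∷ w)     eq = ⊥-elim (dead-rejects w eq)
  initial-accepts⁻ (b ∷ w)     eq with count-accepts⁻ unmarked Fin.zero w eq
  ... | _ , refl , h = unmarked (%≡pred⇒∣suc h)
  initial-accepts⁻ (c ∷ [])    ()
  initial-accepts⁻ (c ∷ a ∷ w) eq = ⊥-elim (dead-rejects w eq)
  initial-accepts⁻ (c ∷ b ∷ w) eq with count-accepts⁻ marked Fin.zero w eq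
  ... | _ , refl , h = marked (%≡pred⇒∣suc h)
  initial-accepts⁻ (c ∷ c ∷ w) eq = ⊥-elim (dead-rejects w eq)

  initial-accepts⁺ : ∀ {w} → Lang (suc s) (suc t) w → foldl step initial w ≡ accept
  initial-accepts⁺ (unmarked {i} d) = count-accepts⁺ unmarked Fin.zero i (∣suc⇒%≡pred d)
  initial-accepts⁺ (marked {i} d)   = count-accepts⁺ marked Fin.zero i (∣suc⇒%≡pred d)

  final⇔Lang : ∀ w → final (foldl step initial w) ≡ true ⇔ Lang (suc s) (suc t) w
  final⇔Lang w = mk⇔ (initial-accepts⁻ w ∘ final-true) (cong final ∘ initial-accepts⁺)
    where
    final-true : ∀ {q} → final q ≡ true → q ≡ accept
    final-true {accept} _ = refl

  size : ℕ
  size = 4 + (suc s + suc t)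

  encode : State → Fin size
  encode initial            = Fin.zero
  encode afterMark          = Fin.suc Fin.zero
  encode accept             = Fin.suc (Fin.suc Fin.zero)
  encode dead               = Fin.suc (Fin.suc (Fin.suc Fin.zero))
  encode (count unmarked r) = 4 ↑ʳ (r ↑ˡ suc t)
  encode (count marked r)   = 4 ↑ʳ (suc s ↑ʳ r)

  decode : Fin size → State
  decode Fin.zero                                  = initial
  decode (Fin.suc Fin.zero)                        = afterMark
  decode (Fin.suc (Fin.suc Fin.zero))              = accept
  decode (Fin.suc (Fin.suc (Fin.suc Fin.zero)))    = dead
  decode (Fin.suc (Fin.suc (Fin.suc (Fin.suc k)))) = [ count unmarked , count marked ]′ (splitAt (suc s) k)

  decode∘encode : ∀ q → decode (encode q) ≡ q
  decode∘encode initial            = refl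
  decode∘encode afterMark          = refl
  decode∘encode accept             = refl
  decode∘encode dead               = refl
  decode∘encode (count unmarked r) = cong [ count unmarked , count marked ]′ (splitAt-↑ˡ (suc s) r (suc t))
  decode∘encode (count marked r)   = cong [ count unmarked , count marked ]′ (splitAt-↑ʳ (suc s) (suc t) r)

  dfa : DFA 3 size
  dfa = encodeDFA encode decode step initial final

  Accepts-dfa⇔Lang : ∀ w → Accepts dfa w ⇔ Lang (suc s) (suc t) w
  Accepts-dfa⇔Lang w = final⇔Lang w ⇔-∘ Accepts-encodeDFA encode decode decode∘encode step initial final w

  ∈Lang : ∀ {w} → Accepts dfa w → Lang (suc s) (suc t) w
  ∈Lang = Equivalence.to (Accepts-dfa⇔Lang _)

  ∈dfa : ∀ {w} → Lang (suc s) (suc t) w → Accepts dfa w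
  ∈dfa = Equivalence.from (Accepts-dfa⇔Lang _)

  common-index⇒¬FactorFree : ∀ i → suc s ∣ suc i → suc t ∣ suc i → ¬ FactorFree dfa
  common-index⇒¬FactorFree i p∣ q∣ factorFree =
    factorFree v (c ∷ v) (∈dfa (unmarked p∣) , ∈dfa (marked q∣) , c∷v⊒v , λ ())
    where
    v : Word 3
    v = b ∷ block i
    c∷v⊒v : Factor v (c ∷ v)
    c∷v⊒v = [ c ] , [] , cong (c ∷_) (sym (++-identityʳ v))

  Witness⇒common-index : ∀ {v w} → Witness dfa v w →
                         ∃ λ i → suc s ∣ suc i × suc t ∣ suc i × w ≡ c ∷ b ∷ block i
  Witness⇒common-index (v∈ , w∈ , v⊑w , v≢w) = Lang-proper-factor (∈Lang v∈) (∈Lang w∈) v⊑w v≢w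

size≤7*suc : ∀ n → Automaton.size n (suc n) ≤ 7 * suc n
size≤7*suc n = subst (Automaton.size n (suc n) ≤_) (sym (7*suc≡ n)) (m≤m+n _ (5 * n))
  where
  7*suc≡ : ∀ n → 7 * suc n ≡ 4 + (suc n + suc (suc n)) + 5 * n
  7*suc≡ = solve-∀

¬FactorFree-dfa : ∀ n → ¬ FactorFree (Automaton.dfa n (suc n))
¬FactorFree-dfa n = Automaton.common-index⇒¬FactorFree n (suc n)
  (pred (suc n * suc (suc n))) (m∣m*n (suc (suc n))) (n∣m*n (suc n))

Witness-dfa⇒square≤ : ∀ n {v w} → Witness (Automaton.dfa n (suc n)) v w → suc n * suc n ≤ length w
Witness-dfa⇒square≤ n wit with Automaton.Witness⇒common-index n (suc n) wit
... | i , n∣ , suc-n∣ , refl = consecutive-∣⇒square≤ n∣ suc-n∣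

theorem9 : ∃ λ (d : ℕ) → 1 ≤ d × ∃ λ (K : ℕ) → ∃ λ (k : ℕ) →
    ∀ (n : ℕ) → 1 ≤ n →
    ∃ λ (m : ℕ) → m ≤ K * n × ∃ λ (A : DFA k m) →
    ¬ FactorFree A ×
    (∀ (v w : Word k) → Witness A v w → n * n ≤ d * length w)
theorem9 = 1 , ≤-refl , 7 , 3 , λ where
  (suc n) _ → Automaton.size n (suc n) , size≤7*suc n , Automaton.dfa n (suc n) , ¬FactorFree-dfa n ,
    λ v w wit → subst (suc n * suc n ≤_) (sym (*-identityˡ (length w))) (Witness-dfa⇒square≤ n wit)
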